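{- Let $G$ be a graph, $v \in V(G)$ with $|N_G(v)| = k$, and let $\mathcal{H} = (L,H)$ be a $k$-fold cover of $G$. Then there are at most $k!$ distinct independent sets in $H\left[\bigcup_{u \in N_G(v)} L(u)\right]$ that are bad for $v$.
   Context: All graphs are finite and simple; $N_G(v)$ is the set of neighbors of $v$ in $G$, and $H[S]$ is the subgraph induced by $S$. A cover of a graph $G$ is a pair $\mathcal{H}=(L,H)$ where $H$ is a graph and $L: V(G) \to \mathcal{P}(V(H))$ satisfies: (1) the sets $\{L(u): u \in V(G)\}$ partition $V(H)$; (2) for every $u \in V(G)$, $H[L(u)]$ is complete; (3) if $E_H(L(u),L(w))$ (the set of edges of $H$ with one endpoint in $L(u)$ and the other in $L(w)$) is nonempty, then $u=w$ or $uw \in E(G)$; (4) if $uw \in E(G)$ then $E_H(L(u),L(w))$ is a matching (possibly empty). The cover is $k$-fold if $|L(u)|=k$ for all $u \in V(G)$. For $v \in V(G)$, an independent set $I$ in $H\left[\bigcup_{u \in N_G(v)} L(u)\right]$ is called bad for $v$ if $|I| = |N_G(v)|$ and every vertex $w \in L(v)$ is adjacent in $H$ to some vertex of $I$. -}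

module Defs where

open import Data.Nat using (ℕ)
open import Data.Bool using (Bool; true; false)
open import Data.Fin using (Fin)
open import Data.Fin.Subset using (Subset; _∈_; ∣_∣)
open import Data.Vec using (tabulate)
open import Data.Product using (Σ; ∃; _×_)
open import Data.Sum using (_⊎_)
open import Data.List using (List; length)
open import Data.List.Relation.Unary.All using (All)
open import Data.List.Relation.Unary.Unique.Propositional using (Unique)
open import Relation.Nullary using (¬_)
open import Relation.Binary.PropositionalEquality using (_≡_; _≢_)

record Graph (n : ℕ) : Set where
  field
    adj   : Fin n → Fin n → Bool
    sym   : ∀ u w → adj u w ≡ adj w u
    irrefl : ∀ u → adj u u ≡ false

open Graph public

N : ∀ {n} → Graph n → Fin n → Subset n
N G v = tabulate (adj G v)

record IsCover {n m : ℕ} (G : Graph n) (H : Graph m) (L : Fin n → Subset m) : Set where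
  field
    covers    : ∀ (x : Fin m) → ∃ λ u → x ∈ L u
    disjoint  : ∀ (x : Fin m) u w → x ∈ L u → x ∈ L w → u ≡ w
    complete  : ∀ u x y → x ∈ L u → y ∈ L u → x ≢ y → adj H x y ≡ true
    edges-ok  : ∀ u w x y → x ∈ L u → y ∈ L w → adj H x y ≡ true →
                u ≡ w ⊎ adj G u w ≡ true
    matching  : ∀ u w → adj G u w ≡ true →
                ∀ x y y' → x ∈ L u → y ∈ L w → y' ∈ L w →
                adj H x y ≡ true → adj H x y' ≡ true → y ≡ y'

IsKFoldCover : ∀ {n m : ℕ} → ℕ → Graph n → Graph m → (Fin n → Subset m) → Set
IsKFoldCover k G H L = IsCover G H L × (∀ u → ∣ L u ∣ ≡ k)

IsIndepInNbhd : ∀ {n m} → Graph n → Graph m → (Fin n → Subset m) → Fin n → Subset m → Set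
IsIndepInNbhd G H L v I =
  (∀ x → x ∈ I → ∃ λ u → u ∈ N G v × x ∈ L u) ×
  (∀ x y → x ∈ I → y ∈ I → adj H x y ≡ false)

IsBad : ∀ {n m} → Graph n → Graph m → (Fin n → Subset m) → Fin n → Subset m → Set
IsBad G H L v I =
  IsIndepInNbhd G H L v I ×
  ∣ I ∣ ≡ ∣ N G v ∣ ×
  (∀ w → w ∈ L v → ∃ λ x → x ∈ I × adj H w x ≡ true)

-- A bad set I meets each fibre L(u), u ∈ N(v), in at most one vertex and
-- dominates L(v). Fix w₀ ∈ L(v) and group the bad sets by a fibre L(c) that
-- contains a neighbour of w₀ in I; there are k choices of c. By the matching
-- condition w₀ has only one neighbour in L(c), so within a group I is
-- determined by I ∖ L(c), which is again such a set for N(v) ∖ {c} and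
-- L(v) ∖ {w₀}. Induction on k bounds the number of bad sets by k · (k - 1)! = k!.
module Submission where

open import Defs hiding (sym)
open import Data.Nat using (ℕ; _≤_)
open import Data.Nat using (_!)
open import Data.Fin using (Fin)
open import Data.Fin.Subset using (Subset; ∣_∣)
open import Data.List using (List; length)
open import Data.List.Relation.Unary.All using (All)
open import Data.List.Relation.Unary.Unique.Propositional using (Unique)
open import Relation.Binary.PropositionalEquality using (_≡_)

open import Data.Bool using (true; false) renaming (_≟_ to _≟ᵇ_)
open import Data.Fin using (zero; suc) renaming (_≟_ to _≟ᶠ_)
open import Data.Fin.Properties using (any?)
open import Data.Fin.Subset
  using (_∈_; _∉_; _⊆_; _─_; _-_; ⁅_⁆; inside; outside; Nonempty) renaming (⊥ to ∅)
open import Data.Fin.Subset.Properties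
  using (_∈?_; ⊆-antisym; p─⊥≡p; p─q⊆p; x∈p∧x∉q⇒x∈p─q; x∈p∧x≢y⇒x∈p-y;
         x∉⁅y⁆⇒x≢y; nonempty?; Empty-unique; ∣⊥∣≡0)
open import Data.List using ([]; _∷_; map; filter)
open import Data.List.Properties using (length-map)
open import Data.List.Relation.Unary.All using ([]; _∷_)
import Data.List.Relation.Unary.All as All
import Data.List.Relation.Unary.All.Properties as All
open import Data.List.Relation.Unary.AllPairs using ([]; _∷_)
import Data.List.Relation.Unary.Unique.Propositional.Properties as Unique
open import Data.Nat using (zero; suc; _+_; _*_; z≤n; s≤s)
open import Data.Nat.Properties using (+-suc; +-mono-≤; suc-injective; module ≤-Reasoning)
open import Data.Product using (∃; _×_; _,_; proj₁; proj₂)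
open import Data.Vec using ([]; _∷_; here; there)
open import Data.Vec.Properties using ([]=⇒lookup; lookup∘tabulate)
open import Relation.Nullary using (¬_; Dec; does; yes; no; contradiction; ¬?)
open import Function using (_∘_)
open import Relation.Nullary.Decidable using (_×-dec_)
open import Relation.Binary.PropositionalEquality
  using (_≢_; refl; sym; trans; cong; subst)

x∈p─q⇒x∉q : ∀ {n} {x : Fin n} {p q : Subset n} → x ∈ p ─ q → x ∉ q
x∈p─q⇒x∉q {p = _ ∷ p} {outside ∷ q} here       ()
x∈p─q⇒x∉q {p = _ ∷ p} {_ ∷ q}       (there x∈) (there x∈q) = x∈p─q⇒x∉q {p = p} x∈ x∈q

x∈p-y⇒x≢y : ∀ {n} {x y : Fin n} {p : Subset n} → x ∈ p - y → x ≢ y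
x∈p-y⇒x≢y x∈ = x∉⁅y⁆⇒x≢y (x∈p─q⇒x∉q x∈)

x∈p⇒suc∣p-x∣≡∣p∣ : ∀ {n} {x : Fin n} {p : Subset n} → x ∈ p → suc ∣ p - x ∣ ≡ ∣ p ∣
x∈p⇒suc∣p-x∣≡∣p∣ {x = zero}  {inside ∷ p}  here        = cong (suc ∘ ∣_∣) (p─⊥≡p p)
x∈p⇒suc∣p-x∣≡∣p∣ {x = suc x} {inside ∷ p}  (there x∈p) = cong suc (x∈p⇒suc∣p-x∣≡∣p∣ x∈p)
x∈p⇒suc∣p-x∣≡∣p∣ {x = suc x} {outside ∷ p} (there x∈p) = x∈p⇒suc∣p-x∣≡∣p∣ x∈p

∣p∣≡0⇒x∉p : ∀ {n} {x : Fin n} {p : Subset n} → ∣ p ∣ ≡ 0 → x ∉ p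
∣p∣≡0⇒x∉p ∣p∣≡0 x∈p with () ← trans (x∈p⇒suc∣p-x∣≡∣p∣ x∈p) ∣p∣≡0

∣p∣≡suc⇒Nonempty : ∀ {n j} {p : Subset n} → ∣ p ∣ ≡ suc j → Nonempty p
∣p∣≡suc⇒Nonempty {n} {p = p} ∣p∣≡1+j with nonempty? p
... | yes ne = ne
... | no ¬ne with () ← trans (sym ∣p∣≡1+j) (trans (cong ∣_∣ (Empty-unique ¬ne)) (∣⊥∣≡0 n))

module _ {A : Set} where

  unique-constant⇒length≤1 : ∀ {a : A} {xs} → Unique xs → All (_≡ a) xs → length xs ≤ 1
  unique-constant⇒length≤1 {xs = []}         _               _                = z≤n
  unique-constant⇒length≤1 {xs = _ ∷ []}     _               _                = s≤s z≤n
  unique-constant⇒length≤1 {xs = _ ∷ _ ∷ _} ((x≢y ∷ _) ∷ _) (x≡a ∷ y≡a ∷ _) =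
    contradiction (trans x≡a (sym y≡a)) x≢y

  map⁺-injectiveOn : ∀ {B : Set} {P : A → Set} {f : A → B} →
                     (∀ {x y} → P x → P y → f x ≡ f y → x ≡ y) →
                     ∀ {xs} → All P xs → Unique xs → Unique (map f xs)
  map⁺-injectiveOn inj []         []           = []
  map⁺-injectiveOn inj (px ∷ pxs) (x∉ ∷ xs!) =
    All.map⁺ (All.zipWith (λ (py , x≢y) fx≡fy → x≢y (inj px py fx≡fy)) (pxs , x∉))
    ∷ map⁺-injectiveOn inj pxs xs!

  length-filter+filter-∁ : ∀ {P : A → Set} (P? : ∀ x → Dec (P x)) xs →
                           length xs ≡ length (filter P? xs) + length (filter (¬? ∘ P?) xs)
  length-filter+filter-∁ P? []       = refl
  length-filter+filter-∁ P? (x ∷ xs) with ih ← length-filter+filter-∁ P? xs | does (P? x)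
  ... | true  = cong suc ih
  ... | false = trans (cong suc ih) (sym (+-suc _ _))

module _ {A : Set} {P : A → Set} where

  length≤∣colours∣*classSize : ∀ {n} (T : A → Fin n → Set) → (∀ x c → Dec (T x c)) →
    ∀ (C : Subset n) {b} →
    (∀ c → c ∈ C → ∀ {ys} → Unique ys → All (λ y → P y × T y c) ys → length ys ≤ b) →
    ∀ {xs} → Unique xs → All (λ x → P x × ∃ λ c → c ∈ C × T x c) xs →
    length xs ≤ ∣ C ∣ * b
  length≤∣colours∣*classSize T T? [] bound {[]}    _ _                    = z≤n
  length≤∣colours∣*classSize T T? [] bound {_ ∷ _} _ ((_ , _ , () , _) ∷ _)
  length≤∣colours∣*classSize T T? (outside ∷ C) bound xs! pxs =
    length≤∣colours∣*classSize (λ x c → T x (suc c)) (λ x c → T? x (suc c)) C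
      (λ c c∈C → bound (suc c) (there c∈C)) xs! (All.map recolour pxs)
    where
    recolour : ∀ {x} → P x × (∃ λ c → c ∈ outside ∷ C × T x c) →
               P x × (∃ λ c → c ∈ C × T x (suc c))
    recolour (px , suc c , there c∈C , t) = px , c , c∈C , t
  length≤∣colours∣*classSize T T? (inside ∷ C) {b} bound {xs} xs! pxs = begin
    length xs                                          ≡⟨ length-filter+filter-∁ T₀? xs ⟩
    length (filter T₀? xs) + length (filter ¬T₀? xs)   ≤⟨ +-mono-≤ first-class other-classes ⟩
    b + ∣ C ∣ * b                                      ∎
    where
    open ≤-Reasoning
    T₀? : ∀ x → Dec (T x zero)
    T₀? x = T? x zero
    ¬T₀? : ∀ x → Dec (¬ T x zero)
    ¬T₀? = ¬? ∘ T₀?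
    recolour : ∀ {x} → (P x × ∃ λ c → c ∈ inside ∷ C × T x c) × ¬ T x zero →
               P x × (∃ λ c → c ∈ C × T x (suc c))
    recolour ((px , zero , _ , t) , ¬t)         = contradiction t ¬t
    recolour ((px , suc c , there c∈C , t) , _) = px , c , c∈C , t
    first-class : length (filter T₀? xs) ≤ b
    first-class = bound zero here (Unique.filter⁺ T₀? xs!)
      (All.zip (All.filter⁺ T₀? (All.map proj₁ pxs) , All.all-filter T₀? xs))
    other-classes : length (filter ¬T₀? xs) ≤ ∣ C ∣ * b
    other-classes = length≤∣colours∣*classSize (λ x c → T x (suc c)) (λ x c → T? x (suc c)) C
      (λ c c∈C → bound (suc c) (there c∈C)) (Unique.filter⁺ ¬T₀? xs!)
      (All.zipWith recolour (All.filter⁺ ¬T₀? pxs , All.all-filter ¬T₀? xs))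

module DominatingTransversals {n m} (H : Graph m) (L : Fin n → Subset m) where

  _~_ : Fin m → Fin m → Set
  x ~ y = adj H x y ≡ true

  ~-sym : ∀ {x y} → x ~ y → y ~ x
  ~-sym {x} {y} x~y = trans (Graph.sym H y x) x~y

  record DominatingTransversal (C : Subset n) (W I : Subset m) : Set where
    field
      covered-by-fibres : ∀ x → x ∈ I → ∃ λ u → u ∈ C × x ∈ L u
      one-per-fibre     : ∀ {x y u} → x ∈ I → y ∈ I → x ∈ L u → y ∈ L u → x ≡ y
      dominates         : ∀ w → w ∈ W → ∃ λ x → x ∈ I × w ~ x

  open DominatingTransversal

  AtMostOneNeighbourIn : Subset m → Fin m → Set
  AtMostOneNeighbourIn S x = ∀ {y y′} → y ∈ S → y′ ∈ S → x ~ y → x ~ y′ → y ≡ y′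

  record Matched (C : Subset n) (W : Subset m) : Set where
    field
      fibre-to-W : ∀ {u x} → u ∈ C → x ∈ L u → AtMostOneNeighbourIn W x
      W-to-fibre : ∀ {w u} → w ∈ W → u ∈ C → AtMostOneNeighbourIn (L u) w

  open Matched

  Matched-mono : ∀ {C C′ W W′} → C′ ⊆ C → W′ ⊆ W → Matched C W → Matched C′ W′
  Matched-mono C′⊆C W′⊆W matched = record
    { fibre-to-W = λ u∈C′ x∈Lu y∈ y′∈ →
        fibre-to-W matched (C′⊆C u∈C′) x∈Lu (W′⊆W y∈) (W′⊆W y′∈)
    ; W-to-fibre = λ w∈W′ u∈C′ → W-to-fibre matched (W′⊆W w∈W′) (C′⊆C u∈C′)
    }

  NeighbourInFibre : Fin m → Subset m → Fin n → Set
  NeighbourInFibre w I c = ∃ λ y → y ∈ I × y ∈ L c × w ~ y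

  neighbourInFibre? : ∀ w I c → Dec (NeighbourInFibre w I c)
  neighbourInFibre? w I c = any? λ y → y ∈? I ×-dec y ∈? L c ×-dec adj H w y ≟ᵇ true

  neighbourInSomeFibre : ∀ {C W I w} → DominatingTransversal C W I → w ∈ W →
                         ∃ λ c → c ∈ C × NeighbourInFibre w I c
  neighbourInSomeFibre dt w∈W with dominates dt _ w∈W
  ... | x , x∈I , w~x with covered-by-fibres dt x x∈I
  ... | c , c∈C , x∈Lc = c , c∈C , x , x∈I , x∈Lc , w~x

  -- Only w₀ can be dominated through L c: the vertex of I in L c is matched to w₀.
  remove-fibre : ∀ {C W I w₀ c} → Matched C W → w₀ ∈ W → c ∈ C →
                 DominatingTransversal C W I → NeighbourInFibre w₀ I c →
                 DominatingTransversal (C - c) (W - w₀) (I ─ L c)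
  remove-fibre {C} {W} {I} {w₀} {c} matched w₀∈W c∈C dt (y , y∈I , y∈Lc , w₀~y) = record
    { covered-by-fibres = covered
    ; one-per-fibre     = λ x∈ x′∈ → one-per-fibre dt (p─q⊆p I (L c) x∈) (p─q⊆p I (L c) x′∈)
    ; dominates         = dominates′
    }
    where
    covered : ∀ x → x ∈ I ─ L c → ∃ λ u → u ∈ C - c × x ∈ L u
    covered x x∈ with covered-by-fibres dt x (p─q⊆p I (L c) x∈)
    ... | u , u∈C , x∈Lu = u , x∈p∧x≢y⇒x∈p-y u∈C (λ { refl → x∈p─q⇒x∉q x∈ x∈Lu }) , x∈Lu
    dominates′ : ∀ w → w ∈ W - w₀ → ∃ λ x → x ∈ I ─ L c × w ~ x
    dominates′ w w∈ with dominates dt w (p─q⊆p W ⁅ w₀ ⁆ w∈)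
    ... | x , x∈I , w~x with x ∈? L c
    ... | no x∉Lc  = x , x∈p∧x∉q⇒x∈p─q x∈I x∉Lc , w~x
    ... | yes x∈Lc = contradiction w≡w₀ (x∈p-y⇒x≢y w∈)
      where
      w≡w₀ : w ≡ w₀
      w≡w₀ = fibre-to-W matched c∈C y∈Lc (p─q⊆p W ⁅ w₀ ⁆ w∈) w₀∈W
        (~-sym (subst (w ~_) (one-per-fibre dt x∈I y∈I x∈Lc y∈Lc) w~x)) (~-sym w₀~y)

  ⊆-of-equal-remainders : ∀ {C W I J w₀ c} → Matched C W → w₀ ∈ W → c ∈ C →
                          DominatingTransversal C W I → NeighbourInFibre w₀ I c →
                          NeighbourInFibre w₀ J c → I ─ L c ≡ J ─ L c → I ⊆ J
  ⊆-of-equal-remainders {I = I} {J} {c = c} matched w₀∈W c∈C dt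
    (y , y∈I , y∈Lc , w₀~y) (y′ , y′∈J , y′∈Lc , w₀~y′) I─Lc≡J─Lc {x} x∈I with x ∈? L c
  ... | yes x∈Lc = subst (_∈ J) (sym (trans (one-per-fibre dt x∈I y∈I x∈Lc y∈Lc)
                     (W-to-fibre matched w₀∈W c∈C y∈Lc y′∈Lc w₀~y w₀~y′))) y′∈J
  ... | no x∉Lc  = p─q⊆p J (L c) (subst (x ∈_) I─Lc≡J─Lc (x∈p∧x∉q⇒x∈p─q x∈I x∉Lc))

  length≤! : ∀ j {C W} → ∣ C ∣ ≡ j → ∣ W ∣ ≡ j → Matched C W →
             ∀ {Is} → Unique Is → All (DominatingTransversal C W) Is → length Is ≤ j !
  length≤! zero ∣C∣≡0 _ _ Is! dts = unique-constant⇒length≤1 Is! (All.map empty dts)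
    where
    empty : ∀ {I} → DominatingTransversal _ _ I → I ≡ ∅
    empty dt = Empty-unique λ (x , x∈I) → ∣p∣≡0⇒x∉p ∣C∣≡0 (proj₁ (proj₂ (covered-by-fibres dt x x∈I)))
  length≤! (suc j) {C} {W} ∣C∣≡1+j ∣W∣≡1+j matched {Is} Is! dts
    with w₀ , w₀∈W ← ∣p∣≡suc⇒Nonempty ∣W∣≡1+j =
    subst (λ s → length Is ≤ s * j !) ∣C∣≡1+j
      (length≤∣colours∣*classSize (NeighbourInFibre w₀) (neighbourInFibre? w₀) C class-bound
        Is! (All.map (λ dt → dt , neighbourInSomeFibre dt w₀∈W) dts))
    where
    class-bound : ∀ c → c ∈ C → ∀ {Js} → Unique Js →
                  All (λ J → DominatingTransversal C W J × NeighbourInFibre w₀ J c) Js →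
                  length Js ≤ j !
    class-bound c c∈C {Js} Js! pJs = begin
      length Js                 ≡⟨ length-map (_─ L c) Js ⟨
      length (map (_─ L c) Js)  ≤⟨ length≤! j ∣C-c∣≡j ∣W-w₀∣≡j matched′
                                     (map⁺-injectiveOn remainder-injective pJs Js!)
                                     (All.map⁺ (All.map remove pJs)) ⟩
      j !                       ∎
      where
      open ≤-Reasoning
      ∣C-c∣≡j : ∣ C - c ∣ ≡ j
      ∣C-c∣≡j = suc-injective (trans (x∈p⇒suc∣p-x∣≡∣p∣ c∈C) ∣C∣≡1+j)
      ∣W-w₀∣≡j : ∣ W - w₀ ∣ ≡ j
      ∣W-w₀∣≡j = suc-injective (trans (x∈p⇒suc∣p-x∣≡∣p∣ w₀∈W) ∣W∣≡1+j)
      matched′ : Matched (C - c) (W - w₀)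
      matched′ = Matched-mono (p─q⊆p C ⁅ c ⁆) (p─q⊆p W ⁅ w₀ ⁆) matched
      remove : ∀ {J} → DominatingTransversal C W J × NeighbourInFibre w₀ J c →
               DominatingTransversal (C - c) (W - w₀) (J ─ L c)
      remove (dt , nb) = remove-fibre matched w₀∈W c∈C dt nb
      remainder-injective : ∀ {I J} →
        DominatingTransversal C W I × NeighbourInFibre w₀ I c →
        DominatingTransversal C W J × NeighbourInFibre w₀ J c →
        I ─ L c ≡ J ─ L c → I ≡ J
      remainder-injective (dtI , nbI) (dtJ , nbJ) eq = ⊆-antisym
        (⊆-of-equal-remainders matched w₀∈W c∈C dtI nbI nbJ eq)
        (⊆-of-equal-remainders matched w₀∈W c∈C dtJ nbJ nbI (sym eq))

lemma6 : ∀ {n m : ℕ} (G : Graph n) (v : Fin n) (k : ℕ) → ∣ N G v ∣ ≡ k →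
         (H : Graph m) (L : Fin n → Subset m) → IsKFoldCover k G H L →
         (Is : List (Subset m)) → Unique Is → All (IsBad G H L v) Is →
         length Is ≤ k !
lemma6 G v k ∣Nv∣≡k H L (cover , k-fold) Is Is! bad =
  length≤! k ∣Nv∣≡k (k-fold v) matched Is! (All.map transversal bad)
  where
  open IsCover cover using (complete; matching)
  open DominatingTransversals H L

  adjacent : ∀ {u} → u ∈ N G v → adj G v u ≡ true
  adjacent {u} u∈N = trans (sym (lookup∘tabulate (adj G v) u)) ([]=⇒lookup u∈N)

  matched : Matched (N G v) (L v)
  matched = record
    { fibre-to-W = λ {u} u∈N x∈Lu →
        matching u v (trans (Graph.sym G u v) (adjacent u∈N)) _ _ _ x∈Lu
    ; W-to-fibre = λ w∈Lv u∈N → matching v _ (adjacent u∈N) _ _ _ w∈Lv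
    }

  -- The size condition on a bad set is implied by the others and not needed.
  transversal : ∀ {I} → IsBad G H L v I → DominatingTransversal (N G v) (L v) I
  transversal ((covered , independent) , _ , dominating) = record
    { covered-by-fibres = covered
    ; one-per-fibre     = one-per-fibre
    ; dominates         = dominating
    }
    where
    one-per-fibre : ∀ {x y u} → x ∈ _ → y ∈ _ → x ∈ L u → y ∈ L u → x ≡ y
    one-per-fibre {x} {y} {u} x∈I y∈I x∈Lu y∈Lu with x ≟ᶠ y
    ... | yes x≡y = x≡y
    ... | no x≢y with () ← trans (sym (complete u x y x∈Lu y∈Lu x≢y)) (independent x y x∈I y∈I)
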